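{- For any integer $d \ge 15$, there exist infinitely many polynomials $f \in \mathbb{Z}[x]$ of degree $d$ such that every polynomial $g \in \mathbb{Z}[x]$ satisfying $L(f-g) \le 1$ is not square-free.
   Context: For $h(x) = a_n x^n + \cdots + a_0 \in \mathbb{Z}[x]$, its length is $L(h) = |a_n| + |a_{n-1}| + \cdots + |a_0|$ (with $L(0)=0$). A polynomial $g \in \mathbb{Z}[x]$ is called square-free if there is no polynomial $h \in \mathbb{Z}[x]$ of degree at least $1$ such that $h^2$ divides $g$. -}

module Defs where

open import Data.Nat using (ℕ; zero; suc; _<_; _≤_)
open import Data.Integer using (ℤ; 0ℤ; _+_; _*_; -_; ∣_∣)
open import Data.List using (List; []; _∷_; map)
open import Data.Nat.ListAction using (sum)
open import Data.List.Relation.Unary.All using (All)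
open import Data.Product using (Σ; ∃; _×_; _,_)
open import Relation.Binary.PropositionalEquality using (_≡_)
open import Relation.Nullary using (¬_)

-- A polynomial in ℤ[x] is represented by its list of coefficients,
-- constant term first: a₀ ∷ a₁ ∷ … ∷ aₙ ∷ [].  Trailing zeros are allowed;
-- polynomials are compared coefficientwise via _≈ₚ_.
Poly : Set
Poly = List ℤ

coeff : Poly → ℕ → ℤ
coeff []       _       = 0ℤ
coeff (a ∷ p)  zero    = a
coeff (a ∷ p)  (suc i) = coeff p i

_≈ₚ_ : Poly → Poly → Set
p ≈ₚ q = ∀ i → coeff p i ≡ coeff q i

_+ₚ_ : Poly → Poly → Poly
[]      +ₚ q       = q
(a ∷ p) +ₚ []      = a ∷ p
(a ∷ p) +ₚ (b ∷ q) = (a + b) ∷ (p +ₚ q)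

-ₚ_ : Poly → Poly
-ₚ p = map -_ p

_-ₚ_ : Poly → Poly → Poly
p -ₚ q = p +ₚ (-ₚ q)

_*ₚ_ : Poly → Poly → Poly
[]      *ₚ q = []
(a ∷ p) *ₚ q = map (a *_) q +ₚ (0ℤ ∷ (p *ₚ q))

HasDegree : Poly → ℕ → Set
HasDegree p d = ¬ (coeff p d ≡ 0ℤ) × (∀ i → d < i → coeff p i ≡ 0ℤ)

DegreeAtLeast1 : Poly → Set
DegreeAtLeast1 p = ∃ λ i → 1 ≤ i × ¬ (coeff p i ≡ 0ℤ)

_∣ₚ_ : Poly → Poly → Set
h ∣ₚ g = ∃ λ q → g ≈ₚ (h *ₚ q)

L : Poly → ℕ
L p = sum (map ∣_∣ p)

SquareFree : Poly → Set
SquareFree g = ¬ (∃ λ h → DegreeAtLeast1 h × ((h *ₚ h) ∣ₚ g))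

InfinitelyMany : (Poly → Set) → Set
InfinitelyMany P = ∀ (fs : List Poly) → ∃ λ f → P f × All (λ f′ → ¬ (f ≈ₚ f′)) fs

module Submission where

-- Let N = ((x-1)(2x-1)(2x²-1)(2x²-2x+1))², of degree 12 with leading coefficient 64, and
-- let F₀ be a polynomial of degree 13 (a Chinese-remainder solution) with
--   F₀ ≡ 0 mod x²,  F₀ ≡ 1 mod (x-1)²,  F₀ ≡ -1 mod (2x²-1)²,
--   F₀ ≡ x mod (2x²-2x+1)²,  F₀ ≡ -x mod (2x-1)²;
-- each congruence is certified by an explicit quotient checked by computation.
-- For k ≠ 0 the polynomial f = F₀ + k x^(m+2) N has degree m + 14 and leading coefficient 64k.
-- A polynomial e with L(e) ≤ 1 is 0 or ±x^j, so either its coefficients of 1 and x vanish,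
-- or e is one of ±1, ±x.  For g = f - e, in the first case x² divides g; otherwise
-- g = (F₀ - e) + k x^(m+2) N is divisible by the square attached to e above.
-- Taking k larger than the x^d-coefficients of a given finite list gives a new such f.

open import Defs
open import Data.Nat using (ℕ; _≤_)
open import Data.Product using (_×_; ∃; _,_; proj₁; proj₂)
open import Relation.Nullary using (¬_)

open import Data.Nat as ℕ using (zero; suc; _<_; z≤n; s≤s; _∸_)
import Data.Nat.Properties as ℕP
open import Data.Integer using (ℤ; +_; -[1+_]; 0ℤ; ∣_∣; _+_; _*_; -_; _-_)
import Data.Integer.Properties as ℤP
open import Data.Integer.Tactic.RingSolver using (solve-∀)
open import Data.List using (List; []; _∷_; map; length; drop)
open import Data.List.Relation.Unary.All using (All; []; _∷_)
open import Data.Sum using ([_,_]′)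
open import Data.Empty using (⊥; ⊥-elim)
open import Relation.Binary.PropositionalEquality

shift : ℕ → Poly → Poly
shift zero    p = p
shift (suc n) p = 0ℤ ∷ shift n p

scale : ℤ → Poly → Poly
scale k = map (k *_)

coeff-+ : ∀ p q i → coeff (p +ₚ q) i ≡ coeff p i + coeff q i
coeff-+ []      q       i       = sym (ℤP.+-identityˡ _)
coeff-+ (a ∷ p) []      i       = sym (ℤP.+-identityʳ _)
coeff-+ (a ∷ p) (b ∷ q) zero    = refl
coeff-+ (a ∷ p) (b ∷ q) (suc i) = coeff-+ p q i

coeff-scale : ∀ k q i → coeff (scale k q) i ≡ k * coeff q i
coeff-scale k []      i       = sym (ℤP.*-zeroʳ k)
coeff-scale k (b ∷ q) zero    = refl
coeff-scale k (b ∷ q) (suc i) = coeff-scale k q i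

coeff-neg : ∀ q i → coeff (-ₚ q) i ≡ - coeff q i
coeff-neg []      i       = refl
coeff-neg (b ∷ q) zero    = refl
coeff-neg (b ∷ q) (suc i) = coeff-neg q i

coeff-- : ∀ p q i → coeff (p -ₚ q) i ≡ coeff p i - coeff q i
coeff-- p q i = trans (coeff-+ p (-ₚ q) i) (cong (_+_ (coeff p i)) (coeff-neg q i))

coeff-shift : ∀ n q j → coeff (shift n q) (n ℕ.+ j) ≡ coeff q j
coeff-shift zero    q j = refl
coeff-shift (suc n) q j = coeff-shift n q j

shift-[] : ∀ n i → coeff (shift n []) i ≡ 0ℤ
shift-[] zero    i       = refl
shift-[] (suc n) zero    = refl
shift-[] (suc n) (suc i) = shift-[] n i

coeff-beyond : ∀ p i → length p ≤ i → coeff p i ≡ 0ℤ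
coeff-beyond []      i       _         = refl
coeff-beyond (a ∷ p) (suc i) (s≤s len) = coeff-beyond p i len

coeff-recover : ∀ f g i → coeff g i ≡ coeff f i - coeff (f -ₚ g) i
coeff-recover f g i = begin
    coeff g i                                 ≡⟨ g≡f-[f-g] (coeff f i) (coeff g i) ⟩
    coeff f i - (coeff f i - coeff g i)       ≡⟨ cong (_-_ (coeff f i)) (sym (coeff-- f g i)) ⟩
    coeff f i - coeff (f -ₚ g) i              ∎
  where
  open ≡-Reasoning
  g≡f-[f-g] : ∀ a b → b ≡ a - (a - b)
  g≡f-[f-g] = solve-∀

coeff-*-∷ : ∀ a p q i → coeff ((a ∷ p) *ₚ q) i ≡ a * coeff q i + coeff (0ℤ ∷ (p *ₚ q)) i
coeff-*-∷ a p q i =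
  trans (coeff-+ (scale a q) (0ℤ ∷ (p *ₚ q)) i)
        (cong (_+ coeff (0ℤ ∷ (p *ₚ q)) i) (coeff-scale a q i))

∷-cong : ∀ a p q → p ≈ₚ q → (a ∷ p) ≈ₚ (a ∷ q)
∷-cong a p q p≈q zero    = refl
∷-cong a p q p≈q (suc i) = p≈q i

shift-cong : ∀ n p q → p ≈ₚ q → shift n p ≈ₚ shift n q
shift-cong zero    p q p≈q = p≈q
shift-cong (suc n) p q p≈q = ∷-cong 0ℤ (shift n p) (shift n q) (shift-cong n p q p≈q)

scale-cong : ∀ k p q → p ≈ₚ q → scale k p ≈ₚ scale k q
scale-cong k p q p≈q i =
  trans (coeff-scale k p i) (trans (cong (k *_) (p≈q i)) (sym (coeff-scale k q i)))

0∷-scale : ∀ k q i → coeff (0ℤ ∷ scale k q) i ≡ k * coeff (0ℤ ∷ q) i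
0∷-scale k q zero    = sym (ℤP.*-zeroʳ k)
0∷-scale k q (suc i) = coeff-scale k q i

*-distribˡ-+ : ∀ p q r → (p *ₚ (q +ₚ r)) ≈ₚ ((p *ₚ q) +ₚ (p *ₚ r))
*-distribˡ-+ []      q r i = refl
*-distribˡ-+ (a ∷ p) q r i = begin
    coeff ((a ∷ p) *ₚ (q +ₚ r)) i
  ≡⟨ coeff-*-∷ a p (q +ₚ r) i ⟩
    a * coeff (q +ₚ r) i + coeff (0ℤ ∷ (p *ₚ (q +ₚ r))) i
  ≡⟨ cong₂ (λ u v → a * u + v) (coeff-+ q r i) (∷-cong 0ℤ _ ((p *ₚ q) +ₚ (p *ₚ r)) (*-distribˡ-+ p q r) i) ⟩
    a * (coeff q i + coeff r i) + coeff ((0ℤ ∷ (p *ₚ q)) +ₚ (0ℤ ∷ (p *ₚ r))) i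
  ≡⟨ cong (_+_ (a * (coeff q i + coeff r i))) (coeff-+ (0ℤ ∷ (p *ₚ q)) (0ℤ ∷ (p *ₚ r)) i) ⟩
    a * (coeff q i + coeff r i) + (coeff (0ℤ ∷ (p *ₚ q)) i + coeff (0ℤ ∷ (p *ₚ r)) i)
  ≡⟨ interchange a _ _ _ _ ⟩
    (a * coeff q i + coeff (0ℤ ∷ (p *ₚ q)) i) + (a * coeff r i + coeff (0ℤ ∷ (p *ₚ r)) i)
  ≡⟨ sym (cong₂ _+_ (coeff-*-∷ a p q i) (coeff-*-∷ a p r i)) ⟩
    coeff ((a ∷ p) *ₚ q) i + coeff ((a ∷ p) *ₚ r) i
  ≡⟨ sym (coeff-+ ((a ∷ p) *ₚ q) ((a ∷ p) *ₚ r) i) ⟩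
    coeff (((a ∷ p) *ₚ q) +ₚ ((a ∷ p) *ₚ r)) i
  ∎
  where
  open ≡-Reasoning
  interchange : ∀ a x y u v → a * (x + y) + (u + v) ≡ (a * x + u) + (a * y + v)
  interchange = solve-∀

*-scale : ∀ p k q → (p *ₚ scale k q) ≈ₚ scale k (p *ₚ q)
*-scale []      k q i = refl
*-scale (a ∷ p) k q i = begin
    coeff ((a ∷ p) *ₚ scale k q) i
  ≡⟨ coeff-*-∷ a p (scale k q) i ⟩
    a * coeff (scale k q) i + coeff (0ℤ ∷ (p *ₚ scale k q)) i
  ≡⟨ cong₂ (λ u v → a * u + v) (coeff-scale k q i)
           (trans (∷-cong 0ℤ _ (scale k (p *ₚ q)) (*-scale p k q) i) (0∷-scale k (p *ₚ q) i)) ⟩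
    a * (k * coeff q i) + k * coeff (0ℤ ∷ (p *ₚ q)) i
  ≡⟨ pull-out a k _ _ ⟩
    k * (a * coeff q i + coeff (0ℤ ∷ (p *ₚ q)) i)
  ≡⟨ cong (k *_) (sym (coeff-*-∷ a p q i)) ⟩
    k * coeff ((a ∷ p) *ₚ q) i
  ≡⟨ sym (coeff-scale k ((a ∷ p) *ₚ q) i) ⟩
    coeff (scale k ((a ∷ p) *ₚ q)) i
  ∎
  where
  open ≡-Reasoning
  pull-out : ∀ a k x u → a * (k * x) + k * u ≡ k * (a * x + u)
  pull-out = solve-∀

*-0∷ : ∀ p q → (p *ₚ (0ℤ ∷ q)) ≈ₚ (0ℤ ∷ (p *ₚ q))
*-0∷ []      q zero    = refl
*-0∷ []      q (suc i) = refl
*-0∷ (a ∷ p) q zero    = trans (ℤP.+-identityʳ (a * 0ℤ)) (ℤP.*-zeroʳ a)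
*-0∷ (a ∷ p) q (suc i) = begin
    coeff (scale a q +ₚ (p *ₚ (0ℤ ∷ q))) i
  ≡⟨ coeff-+ (scale a q) (p *ₚ (0ℤ ∷ q)) i ⟩
    coeff (scale a q) i + coeff (p *ₚ (0ℤ ∷ q)) i
  ≡⟨ cong (_+_ (coeff (scale a q) i)) (*-0∷ p q i) ⟩
    coeff (scale a q) i + coeff (0ℤ ∷ (p *ₚ q)) i
  ≡⟨ sym (coeff-+ (scale a q) (0ℤ ∷ (p *ₚ q)) i) ⟩
    coeff ((a ∷ p) *ₚ q) i
  ∎
  where open ≡-Reasoning

*-shift : ∀ p n q → (p *ₚ shift n q) ≈ₚ shift n (p *ₚ q)
*-shift p zero    q i = refl
*-shift p (suc n) q i = trans (*-0∷ p (shift n q) i) (∷-cong 0ℤ _ (shift n (p *ₚ q)) (*-shift p n q) i)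

0∷-* : ∀ p q → ((0ℤ ∷ p) *ₚ q) ≈ₚ (0ℤ ∷ (p *ₚ q))
0∷-* p q i =
  trans (coeff-*-∷ 0ℤ p q i)
        (trans (cong (_+ coeff (0ℤ ∷ (p *ₚ q)) i) (ℤP.*-zeroˡ (coeff q i))) (ℤP.+-identityˡ _))

1-* : ∀ q → ((+ 1 ∷ []) *ₚ q) ≈ₚ q
1-* q i =
  trans (coeff-*-∷ (+ 1) [] q i)
        (trans (cong₂ _+_ (ℤP.*-identityˡ (coeff q i)) (shift-[] 1 i)) (ℤP.+-identityʳ _))

monomial-* : ∀ n q → (shift n (+ 1 ∷ []) *ₚ q) ≈ₚ shift n q
monomial-* zero    q = 1-* q
monomial-* (suc n) q i = trans (0∷-* (shift n (+ 1 ∷ [])) q i) (∷-cong 0ℤ _ (shift n q) (monomial-* n q) i)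

∣-resp-≈ : ∀ h p q → p ≈ₚ q → h ∣ₚ p → h ∣ₚ q
∣-resp-≈ h p q p≈q (Q , p≈hQ) = Q , λ i → trans (sym (p≈q i)) (p≈hQ i)

∣-+ : ∀ h p q → h ∣ₚ p → h ∣ₚ q → h ∣ₚ (p +ₚ q)
∣-+ h p q (P , p≈hP) (Q , q≈hQ) = P +ₚ Q , λ i → begin
    coeff (p +ₚ q) i                     ≡⟨ coeff-+ p q i ⟩
    coeff p i + coeff q i                ≡⟨ cong₂ _+_ (p≈hP i) (q≈hQ i) ⟩
    coeff (h *ₚ P) i + coeff (h *ₚ Q) i  ≡⟨ sym (coeff-+ (h *ₚ P) (h *ₚ Q) i) ⟩
    coeff ((h *ₚ P) +ₚ (h *ₚ Q)) i       ≡⟨ sym (*-distribˡ-+ h P Q i) ⟩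
    coeff (h *ₚ (P +ₚ Q)) i              ∎
  where open ≡-Reasoning

∣-shift-scale : ∀ h q n k → h ∣ₚ q → h ∣ₚ shift n (scale k q)
∣-shift-scale h q n k (Q , q≈hQ) = shift n (scale k Q) , λ i → begin
    coeff (shift n (scale k q)) i         ≡⟨ shift-cong n _ _ (scale-cong k q (h *ₚ Q) q≈hQ) i ⟩
    coeff (shift n (scale k (h *ₚ Q))) i  ≡⟨ shift-cong n (scale k (h *ₚ Q)) (h *ₚ scale k Q) (λ j → sym (*-scale h k Q j)) i ⟩
    coeff (shift n (h *ₚ scale k Q)) i    ≡⟨ sym (*-shift h n (scale k Q) i) ⟩
    coeff (h *ₚ shift n (scale k Q)) i    ∎
  where open ≡-Reasoning

vanishing-below : ∀ n g → (∀ i → i < n → coeff g i ≡ 0ℤ) → g ≈ₚ shift n (drop n g)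
vanishing-below zero    g       _    i       = refl
vanishing-below (suc n) []      _    i       = sym (shift-[] (suc n) i)
vanishing-below (suc n) (a ∷ g) low  zero    = low 0 (s≤s z≤n)
vanishing-below (suc n) (a ∷ g) low  (suc i) =
  vanishing-below n g (λ j j<n → low (suc j) (s≤s j<n)) i

monomial-divides : ∀ n g → (∀ i → i < n → coeff g i ≡ 0ℤ) → shift n (+ 1 ∷ []) ∣ₚ g
monomial-divides n g low =
  drop n g , λ i → trans (vanishing-below n g low i) (sym (monomial-* n (drop n g) i))

coeff≤L : ∀ p i → ∣ coeff p i ∣ ≤ L p
coeff≤L []      i       = z≤n
coeff≤L (a ∷ p) zero    = ℕP.m≤m+n ∣ a ∣ (L p)
coeff≤L (a ∷ p) (suc i) = ℕP.≤-trans (coeff≤L p i) (ℕP.m≤n+m (L p) ∣ a ∣)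

coeff+coeff≤L : ∀ p i j → i < j → ∣ coeff p i ∣ ℕ.+ ∣ coeff p j ∣ ≤ L p
coeff+coeff≤L []      i       j       _         = z≤n
coeff+coeff≤L (a ∷ p) zero    (suc j) _         = ℕP.+-monoʳ-≤ ∣ a ∣ (coeff≤L p j)
coeff+coeff≤L (a ∷ p) (suc i) (suc j) (s≤s i<j) =
  ℕP.≤-trans (coeff+coeff≤L p i j i<j) (ℕP.m≤n+m (L p) ∣ a ∣)

no-large-coeff : ∀ p i {c} → L p ≤ 1 → coeff p i ≡ c → 2 ≤ ∣ c ∣ → ⊥
no-large-coeff p i L≤1 refl 2≤c with ℕP.≤-trans 2≤c (ℕP.≤-trans (coeff≤L p i) L≤1)
... | s≤s ()

isolated : ∀ p i j → L p ≤ 1 → ∣ coeff p i ∣ ≡ 1 → i < j → coeff p j ≡ 0ℤ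
isolated p i j L≤1 unit i<j = ℤP.∣i∣≡0⇒i≡0 (ℕP.n≤0⇒n≡0 (ℕ.s≤s⁻¹ 1+∣cⱼ∣≤1))
  where
  1+∣cⱼ∣≤1 : 1 ℕ.+ ∣ coeff p j ∣ ≤ 1
  1+∣cⱼ∣≤1 = subst (λ z → z ℕ.+ ∣ coeff p j ∣ ≤ 1) unit
                   (ℕP.≤-trans (coeff+coeff≤L p i j i<j) L≤1)

constant-shape : ∀ e {c} → L e ≤ 1 → coeff e 0 ≡ c → ∣ c ∣ ≡ 1 → e ≈ₚ (c ∷ [])
constant-shape e L≤1 e₀ unit zero    = e₀
constant-shape e L≤1 e₀ unit (suc j) = isolated e 0 (suc j) L≤1 (trans (cong ∣_∣ e₀) unit) (s≤s z≤n)

linear-shape : ∀ e {c} → L e ≤ 1 → coeff e 0 ≡ 0ℤ → coeff e 1 ≡ c → ∣ c ∣ ≡ 1 →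
               e ≈ₚ (0ℤ ∷ c ∷ [])
linear-shape e L≤1 e₀ e₁ unit zero          = e₀
linear-shape e L≤1 e₀ e₁ unit (suc zero)    = e₁
linear-shape e L≤1 e₀ e₁ unit (suc (suc j)) =
  isolated e 1 (suc (suc j)) L≤1 (trans (cong ∣_∣ e₁) unit) (s≤s (s≤s z≤n))

data UnitMonomial : Poly → Set where
  one       : UnitMonomial (+ 1 ∷ [])
  minus-one : UnitMonomial (- + 1 ∷ [])
  x         : UnitMonomial (0ℤ ∷ + 1 ∷ [])
  minus-x   : UnitMonomial (0ℤ ∷ - + 1 ∷ [])

data ShortShape (e : Poly) : Set where
  low-coefficients-vanish : coeff e 0 ≡ 0ℤ → coeff e 1 ≡ 0ℤ → ShortShape e
  is-unit-monomial        : ∀ {E} → UnitMonomial E → e ≈ₚ E → ShortShape e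

short-shape : ∀ e → L e ≤ 1 → ShortShape e
short-shape e L≤1 with coeff e 0 in e₀ | coeff e 1 in e₁
... | + 1              | _                = is-unit-monomial one (constant-shape e L≤1 e₀ refl)
... | -[1+ 0 ]         | _                = is-unit-monomial minus-one (constant-shape e L≤1 e₀ refl)
... | + suc (suc _)    | _                = ⊥-elim (no-large-coeff e 0 L≤1 e₀ (s≤s (s≤s z≤n)))
... | -[1+ suc _ ]     | _                = ⊥-elim (no-large-coeff e 0 L≤1 e₀ (s≤s (s≤s z≤n)))
... | + 0              | + 0              = low-coefficients-vanish e₀ e₁
... | + 0              | + 1              = is-unit-monomial x (linear-shape e L≤1 e₀ e₁ refl)
... | + 0              | -[1+ 0 ]         = is-unit-monomial minus-x (linear-shape e L≤1 e₀ e₁ refl)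
... | + 0              | + suc (suc _)    = ⊥-elim (no-large-coeff e 1 L≤1 e₁ (s≤s (s≤s z≤n)))
... | + 0              | -[1+ suc _ ]     = ⊥-elim (no-large-coeff e 1 L≤1 e₁ (s≤s (s≤s z≤n)))

HasDegree-+ : ∀ p q d → (∀ i → d ≤ i → coeff p i ≡ 0ℤ) → HasDegree q d → HasDegree (p +ₚ q) d
HasDegree-+ p q d small (lead≢0 , above) =
    (λ lead≡0 → lead≢0 (trans (sym (only-q d ℕP.≤-refl)) lead≡0))
  , (λ i d<i → trans (only-q i (ℕP.<⇒≤ d<i)) (above i d<i))
  where
  only-q : ∀ i → d ≤ i → coeff (p +ₚ q) i ≡ coeff q i
  only-q i d≤i = trans (coeff-+ p q i) (trans (cong (_+ coeff q i) (small i d≤i)) (ℤP.+-identityˡ _))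

HasDegree-scale : ∀ k q d → ¬ k ≡ 0ℤ → HasDegree q d → HasDegree (scale k q) d
HasDegree-scale k q d k≢0 (lead≢0 , above) =
    (λ klead≡0 → [ k≢0 , lead≢0 ]′ (ℤP.i*j≡0⇒i≡0∨j≡0 k (trans (sym (coeff-scale k q d)) klead≡0)))
  , (λ i d<i → trans (coeff-scale k q i) (trans (cong (k *_) (above i d<i)) (ℤP.*-zeroʳ k)))

HasDegree-shift : ∀ n q d → HasDegree q d → HasDegree (shift n q) (n ℕ.+ d)
HasDegree-shift zero    q d deg = deg
HasDegree-shift (suc n) q d deg = proj₁ deg′ , λ { zero () ; (suc i) (s≤s n+d<i) → proj₂ deg′ i n+d<i }
  where
  deg′ : HasDegree (shift n q) (n ℕ.+ d)
  deg′ = HasDegree-shift n q d deg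

square : Poly → Poly
square h = h *ₚ h

x-1 2x-1 2x²-1 2x²-2x+1 : Poly
x-1       = - + 1 ∷ + 1 ∷ []
2x-1      = - + 1 ∷ + 2 ∷ []
2x²-1     = - + 1 ∷ + 0 ∷ + 2 ∷ []
2x²-2x+1  = + 1 ∷ - + 2 ∷ + 2 ∷ []

N : Poly
N = square (((x-1 *ₚ 2x-1) *ₚ 2x²-1) *ₚ 2x²-2x+1)

N-degree : HasDegree N 12
N-degree = (λ ()) , λ i 12<i → coeff-beyond N i 12<i

F₀ : Poly
F₀ = + 0 ∷ + 0 ∷ - + 247 ∷ + 2014 ∷ - + 6498 ∷ + 8312 ∷ + 6224 ∷ - + 37492 ∷ + 50696 ∷
     - + 11904 ∷ - + 49968 ∷ + 70416 ∷ - + 40832 ∷ + 9280 ∷ []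

record SquareFactor (E : Poly) : Set where
  field
    root         : Poly
    nonconstant  : DegreeAtLeast1 root
    divides-F₀-E : square root ∣ₚ (F₀ -ₚ E)
    divides-N    : square root ∣ₚ N

square-factor : ∀ {E} → UnitMonomial E → SquareFactor E
square-factor one = record
  { root         = x-1
  ; nonconstant  = 1 , s≤s z≤n , λ ()
  ; divides-F₀-E = (- + 1 ∷ - + 2 ∷ - + 250 ∷ + 1516 ∷ - + 3216 ∷ + 364 ∷ + 10168 ∷
                    - + 17520 ∷ + 5488 ∷ + 16592 ∷ - + 22272 ∷ + 9280 ∷ []) , λ _ → refl
  ; divides-N    = square ((2x-1 *ₚ 2x²-1) *ₚ 2x²-2x+1) , λ _ → refl
  }
square-factor minus-one = record
  { root         = 2x²-1
  ; nonconstant  = 2 , s≤s z≤n , λ ()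
  ; divides-F₀-E = (+ 1 ∷ + 0 ∷ - + 243 ∷ + 2014 ∷ - + 7474 ∷ + 16368 ∷ - + 22700 ∷
                    + 19924 ∷ - + 10208 ∷ + 2320 ∷ []) , λ _ → refl
  ; divides-N    = square ((x-1 *ₚ 2x-1) *ₚ 2x²-2x+1) , λ _ → refl
  }
square-factor x = record
  { root         = 2x²-2x+1
  ; nonconstant  = 1 , s≤s z≤n , λ ()
  ; divides-F₀-E = (+ 0 ∷ - + 1 ∷ - + 251 ∷ + 1018 ∷ - + 426 ∷ - + 3540 ∷ + 4620 ∷
                    + 1828 ∷ - + 5568 ∷ + 2320 ∷ []) , λ _ → refl
  ; divides-N    = square ((x-1 *ₚ 2x-1) *ₚ 2x²-1) , λ _ → refl
  }
square-factor minus-x = record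
  { root         = 2x-1
  ; nonconstant  = 1 , s≤s z≤n , λ ()
  ; divides-F₀-E = (+ 0 ∷ + 1 ∷ - + 243 ∷ + 1038 ∷ - + 1374 ∷ - + 1336 ∷ + 6376 ∷
                    - + 6644 ∷ - + 1384 ∷ + 9136 ∷ - + 7888 ∷ + 2320 ∷ []) , λ _ → refl
  ; divides-N    = square ((x-1 *ₚ 2x²-1) *ₚ 2x²-2x+1) , λ _ → refl
  }

family : ℕ → ℤ → Poly
family m k = F₀ +ₚ shift (2 ℕ.+ m) (scale k N)

family-degree : ∀ m k → ¬ k ≡ 0ℤ → HasDegree (family m k) (2 ℕ.+ m ℕ.+ 12)
family-degree m k k≢0 =
  HasDegree-+ F₀ (shift (2 ℕ.+ m) (scale k N)) _ F₀-vanishes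
    (HasDegree-shift (2 ℕ.+ m) (scale k N) 12 (HasDegree-scale k N 12 k≢0 N-degree))
  where
  F₀-vanishes : ∀ i → 2 ℕ.+ m ℕ.+ 12 ≤ i → coeff F₀ i ≡ 0ℤ
  F₀-vanishes i le = coeff-beyond F₀ i (ℕP.≤-trans (s≤s (s≤s (ℕP.m≤n+m 12 m))) le)

family-leading : ∀ m k → coeff (family m k) (2 ℕ.+ m ℕ.+ 12) ≡ k * + 64
family-leading m k = begin
    coeff (F₀ +ₚ shift n (scale k N)) (n ℕ.+ 12)
  ≡⟨ coeff-+ F₀ (shift n (scale k N)) (n ℕ.+ 12) ⟩
    coeff F₀ (n ℕ.+ 12) + coeff (shift n (scale k N)) (n ℕ.+ 12)
  ≡⟨ cong₂ _+_ (coeff-beyond F₀ (n ℕ.+ 12) (s≤s (s≤s (ℕP.m≤n+m 12 m)))) (coeff-shift n (scale k N) 12) ⟩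
    0ℤ + coeff (scale k N) 12
  ≡⟨ ℤP.+-identityˡ _ ⟩
    coeff (scale k N) 12
  ≡⟨ coeff-scale k N 12 ⟩
    k * + 64
  ∎
  where
  open ≡-Reasoning
  n : ℕ
  n = 2 ℕ.+ m

neighbour-decomposition : ∀ F T g E → ((F +ₚ T) -ₚ g) ≈ₚ E → g ≈ₚ ((F -ₚ E) +ₚ T)
neighbour-decomposition F T g E diff≈E i = begin
    coeff g i                                       ≡⟨ coeff-recover (F +ₚ T) g i ⟩
    coeff (F +ₚ T) i - coeff ((F +ₚ T) -ₚ g) i      ≡⟨ cong₂ _-_ (coeff-+ F T i) (diff≈E i) ⟩
    (coeff F i + coeff T i) - coeff E i             ≡⟨ regroup (coeff F i) (coeff T i) (coeff E i) ⟩
    (coeff F i - coeff E i) + coeff T i             ≡⟨ cong (_+ coeff T i) (sym (coeff-- F E i)) ⟩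
    coeff (F -ₚ E) i + coeff T i                    ≡⟨ sym (coeff-+ (F -ₚ E) T i) ⟩
    coeff ((F -ₚ E) +ₚ T) i                         ∎
  where
  open ≡-Reasoning
  regroup : ∀ f t e → (f + t) - e ≡ (f - e) + t
  regroup = solve-∀

neighbour-has-square-factor : ∀ m k g → L (family m k -ₚ g) ≤ 1 →
                              ∃ λ h → DegreeAtLeast1 h × square h ∣ₚ g
neighbour-has-square-factor m k g L≤1 with short-shape (family m k -ₚ g) L≤1
... | low-coefficients-vanish e₀ e₁ =
  0ℤ ∷ + 1 ∷ [] , (1 , s≤s z≤n , λ ()) , monomial-divides 2 g low
  where
  low : ∀ i → i < 2 → coeff g i ≡ 0ℤ
  low zero          _ = trans (coeff-recover (family m k) g 0) (cong (_-_ 0ℤ) e₀)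
  low (suc zero)    _ = trans (coeff-recover (family m k) g 1) (cong (_-_ 0ℤ) e₁)
  low (suc (suc _)) (s≤s (s≤s ()))
... | is-unit-monomial {E} u diff≈E =
  root , nonconstant ,
  ∣-resp-≈ (square root) ((F₀ -ₚ E) +ₚ T) g
    (λ i → sym (neighbour-decomposition F₀ T g E diff≈E i))
    (∣-+ (square root) (F₀ -ₚ E) T divides-F₀-E (∣-shift-scale (square root) N (2 ℕ.+ m) k divides-N))
  where
  open SquareFactor (square-factor u)
  T : Poly
  T = shift (2 ℕ.+ m) (scale k N)

coeff-total : ℕ → List Poly → ℕ
coeff-total d []        = 0
coeff-total d (f′ ∷ fs) = ∣ coeff f′ d ∣ ℕ.+ coeff-total d fs

differs-from-all : ∀ d fs f → coeff-total d fs < ∣ coeff f d ∣ → All (λ f′ → ¬ (f ≈ₚ f′)) fs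
differs-from-all d []        f _   = []
differs-from-all d (f′ ∷ fs) f big =
    (λ f≈f′ → ℕP.<-irrefl refl
       (ℕP.≤-<-trans (ℕP.≤-trans (ℕP.≤-reflexive (cong ∣_∣ (f≈f′ d))) (ℕP.m≤m+n _ _)) big))
  ∷ differs-from-all d fs f (ℕP.≤-<-trans (ℕP.m≤n+m _ _) big)

degree-index : ∀ d → 14 ≤ d → 2 ℕ.+ (d ∸ 14) ℕ.+ 12 ≡ d
degree-index d 14≤d =
  trans (sym (trans (ℕP.+-suc m 13) (cong suc (ℕP.+-suc m 12)))) (ℕP.m∸n+n≡m 14≤d)
  where
  m : ℕ
  m = d ∸ 14

theorem1p3 : ∀ (d : ℕ) → 15 ≤ d →
    InfinitelyMany (λ f → HasDegree f d × (∀ (g : Poly) → L (f -ₚ g) ≤ 1 → ¬ SquareFree g))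
theorem1p3 d 15≤d fs =
  family m k ,
  (subst (HasDegree (family m k)) d≡ (family-degree m k (λ ())) ,
   λ g L≤1 square-free → square-free (neighbour-has-square-factor m k g L≤1)) ,
  differs-from-all d fs (family m k) exceeds
  where
  K : ℕ
  K = coeff-total d fs
  m : ℕ
  m = d ∸ 14
  k : ℤ
  k = + suc K
  d≡ : 2 ℕ.+ m ℕ.+ 12 ≡ d
  d≡ = degree-index d (ℕP.<⇒≤ 15≤d)
  -- the leading coefficient 64k exceeds K
  exceeds : K < ∣ coeff (family m k) d ∣
  exceeds = subst (λ j → K < ∣ coeff (family m k) j ∣) d≡
                  (subst (K <_) (sym (cong ∣_∣ (family-leading m k))) (ℕP.m≤m*n (suc K) 64))
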